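{- Let $G$ be a finite $P_5$-free graph and let $H$ be a subgraph of $G$ that is $P_3$-connected in $G$. Let $u,v\in V(G)\setminus V(H)$ be such that $uv\in E(G)$, $u$ has no neighbour in $V(H)$, and there is an edge $e\in E(H)$ whose two endpoints are both non-neighbours of $v$. Then $v$ has no neighbour in $V(H)$.
   Context: Graphs are finite and simple; $G$ is $P_5$-free if no induced subgraph is isomorphic to the five-vertex path. A subgraph $H$ of $G$ (not necessarily induced) is $P_3$-connected (in $G$) if $H$ is connected and for every two edges $e,f\in E(H)$ there is a sequence of edges $e=e_0,e_1,\dots,e_k=f$ of $H$ such that for each $0\le i\le k-1$, $e_i$ and $e_{i+1}$ are the two edges of an induced three-vertex path in $G$ (i.e. they share exactly one endpoint and their other endpoints are nonadjacent in $G$). -}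

module Defs where

open import Level using (0ℓ)
open import Data.Nat using (ℕ; suc)
open import Data.Fin using (Fin; toℕ)
open import Data.Product using (Σ; _×_; ∃; ∃-syntax)
open import Data.Sum using (_⊎_)
open import Data.Empty using (⊥)
open import Relation.Nullary using (¬_; Dec)
open import Relation.Binary.PropositionalEquality using (_≡_; _≢_)
open import Relation.Binary.Construct.Closure.ReflexiveTransitive using (Star)
open import Function.Definitions using (Injective)

record Graph (n : ℕ) : Set₁ where
  field
    Adj     : Fin n → Fin n → Set
    adj?    : ∀ x y → Dec (Adj x y)
    sym     : ∀ {x y} → Adj x y → Adj y x
    irrefl  : ∀ {x} → ¬ Adj x x
open Graph public

PathAdj : Fin 5 → Fin 5 → Set
PathAdj i j = (toℕ j ≡ suc (toℕ i)) ⊎ (toℕ i ≡ suc (toℕ j))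

InducedP5 : ∀ {n} → Graph n → (Fin 5 → Fin n) → Set
InducedP5 G f = Injective _≡_ _≡_ f × (∀ i j → (Adj G (f i) (f j) → PathAdj i j) × (PathAdj i j → Adj G (f i) (f j)))

P5Free : ∀ {n} → Graph n → Set
P5Free {n} G = ¬ (Σ (Fin 5 → Fin n) λ f → InducedP5 G f)

record Subgraph {n : ℕ} (G : Graph n) : Set₁ where
  field
    VH      : Fin n → Set
    EH      : Fin n → Fin n → Set
    EH-sym  : ∀ {x y} → EH x y → EH y x
    EH-adj  : ∀ {x y} → EH x y → Adj G x y
    EH-V    : ∀ {x y} → EH x y → VH x × VH y
open Subgraph public

-- Edges of H, represented as oriented pairs (an unordered edge {x,y} has two representatives).
EdgeOf : ∀ {n} {G : Graph n} → Subgraph G → Set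
EdgeOf {n} H = Σ (Fin n × Fin n) λ p → EH H (Data.Product.proj₁ p) (Data.Product.proj₂ p)

SamePair : ∀ {n} → Fin n × Fin n → Fin n × Fin n → Set
SamePair (a Data.Product., b) (x Data.Product., y) = ((a ≡ x) × (b ≡ y)) ⊎ ((a ≡ y) × (b ≡ x))

P3Step : ∀ {n} {G : Graph n} (H : Subgraph G) → EdgeOf H → EdgeOf H → Set
P3Step {n} {G} H (e Data.Product., _) (f Data.Product., _) =
  ∃[ x ] ∃[ y ] ∃[ z ] (SamePair e (x Data.Product., y) × SamePair f (x Data.Product., z) × (y ≢ z) × ¬ Adj G y z)

Connected : ∀ {n} {G : Graph n} → Subgraph G → Set
Connected H = ∀ x y → VH H x → VH H y → Star (EH H) x y

P3Connected : ∀ {n} {G : Graph n} → Subgraph G → Set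
P3Connected H = Connected H × (∀ (e f : EdgeOf H) → Star (P3Step H) e f)

{-# OPTIONS --safe #-}
module Submission where

-- Call an edge of H empty if both its ends are non-neighbours of v. If xy is empty
-- and y-x-z is an induced P3 with xz in H but vz an edge, then u-v-z-x-y is an
-- induced P5, since u sees none of x, y, z. Hence P3-steps preserve emptiness, and
-- by P3-connectivity every edge of H is empty; every vertex of H lies on an edge.
-- The five vertices are automatically distinct (P5 has pairwise distinct
-- neighbourhoods).

open import Defs
open import Data.Nat using (suc; _≟_)
open import Data.Fin using (Fin; toℕ) renaming (_≟_ to _≟ᶠ_)
open import Data.Fin.Patterns using (0F; 1F; 2F; 3F; 4F)
open import Data.Fin.Properties using (all?)
open import Data.Product using (_×_; ∃-syntax; _,_; proj₁; proj₂; Σ)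
open import Data.Sum using (inj₁; inj₂)
open import Data.Empty using (⊥-elim)
open import Function using (_∘_; const; id)
open import Function.Definitions using (Injective)
open import Relation.Nullary using (¬_; Dec)
open import Relation.Nullary.Decidable using (True; False; toWitness; toWitnessFalse; _⊎-dec_; _×-dec_; _→-dec_)
open import Relation.Binary.PropositionalEquality using (_≡_; refl; subst) renaming (sym to ≡-sym)
open import Relation.Binary.Construct.Closure.ReflexiveTransitive using (Star; ε; _◅_; fold)

pathAdj? : (i j : Fin 5) → Dec (PathAdj i j)
pathAdj? i j = (toℕ j ≟ suc (toℕ i)) ⊎-dec (toℕ i ≟ suc (toℕ j))

pathAdj-sameNeighbourhood⇒≡ : ∀ i j →
  (∀ k → (PathAdj i k → PathAdj j k) × (PathAdj j k → PathAdj i k)) → i ≡ j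
pathAdj-sameNeighbourhood⇒≡ = toWitness {a? = all? λ i → all? λ j →
  all? (λ k → (pathAdj? i k →-dec pathAdj? j k) ×-dec (pathAdj? j k →-dec pathAdj? i k))
    →-dec (i ≟ᶠ j)} _

module _ {n} (G : Graph n) where

  InducesP5Edges : (Fin 5 → Fin n) → Set
  InducesP5Edges f = ∀ i j → (Adj G (f i) (f j) → PathAdj i j) × (PathAdj i j → Adj G (f i) (f j))

  inducesP5Edges⇒injective : ∀ {f} → InducesP5Edges f → Injective _≡_ _≡_ f
  inducesP5Edges⇒injective {f} edges {i} {j} fi≡fj = pathAdj-sameNeighbourhood⇒≡ i j λ k →
    (proj₁ (edges j k) ∘ subst (λ x → Adj G x (f k)) fi≡fj ∘ proj₂ (edges i k)) ,
    (proj₁ (edges i k) ∘ subst (λ x → Adj G x (f k)) (≡-sym fi≡fj) ∘ proj₂ (edges j k))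

  private
    edge : ∀ {i j x y} {_ : True (pathAdj? i j)} → Adj G x y →
      (Adj G x y → PathAdj i j) × (PathAdj i j → Adj G x y)
    edge {i} {j} {_} {_} {p} x~y = const (toWitness {a? = pathAdj? i j} p) , const x~y

    nonEdge : ∀ {i j x y} {_ : False (pathAdj? i j)} → ¬ Adj G x y →
      (Adj G x y → PathAdj i j) × (PathAdj i j → Adj G x y)
    nonEdge {i} {j} {_} {_} {p} x≁y = ⊥-elim ∘ x≁y , ⊥-elim ∘ toWitnessFalse {a? = pathAdj? i j} p

  inducedP5 : ∀ v₀ v₁ v₂ v₃ v₄ →
    Adj G v₀ v₁ → Adj G v₁ v₂ → Adj G v₂ v₃ → Adj G v₃ v₄ →
    ¬ Adj G v₀ v₂ → ¬ Adj G v₀ v₃ → ¬ Adj G v₀ v₄ → ¬ Adj G v₁ v₃ → ¬ Adj G v₁ v₄ → ¬ Adj G v₂ v₄ →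
    Σ (Fin 5 → Fin n) (InducedP5 G)
  inducedP5 v₀ v₁ v₂ v₃ v₄ a₀₁ a₁₂ a₂₃ a₃₄ n₀₂ n₀₃ n₀₄ n₁₃ n₁₄ n₂₄ =
    f , inducesP5Edges⇒injective edges , edges
    where
    f : Fin 5 → Fin n
    f 0F = v₀
    f 1F = v₁
    f 2F = v₂
    f 3F = v₃
    f 4F = v₄

    edges : InducesP5Edges f
    edges 0F 0F = nonEdge (irrefl G)
    edges 0F 1F = edge a₀₁
    edges 0F 2F = nonEdge n₀₂
    edges 0F 3F = nonEdge n₀₃
    edges 0F 4F = nonEdge n₀₄
    edges 1F 0F = edge (sym G a₀₁)
    edges 1F 1F = nonEdge (irrefl G)
    edges 1F 2F = edge a₁₂
    edges 1F 3F = nonEdge n₁₃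
    edges 1F 4F = nonEdge n₁₄
    edges 2F 0F = nonEdge (n₀₂ ∘ sym G)
    edges 2F 1F = edge (sym G a₁₂)
    edges 2F 2F = nonEdge (irrefl G)
    edges 2F 3F = edge a₂₃
    edges 2F 4F = nonEdge n₂₄
    edges 3F 0F = nonEdge (n₀₃ ∘ sym G)
    edges 3F 1F = nonEdge (n₁₃ ∘ sym G)
    edges 3F 2F = edge (sym G a₂₃)
    edges 3F 3F = nonEdge (irrefl G)
    edges 3F 4F = edge a₃₄
    edges 4F 0F = nonEdge (n₀₄ ∘ sym G)
    edges 4F 1F = nonEdge (n₁₄ ∘ sym G)
    edges 4F 2F = nonEdge (n₂₄ ∘ sym G)
    edges 4F 3F = edge (sym G a₃₄)
    edges 4F 4F = nonEdge (irrefl G)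

samePair-sym : ∀ {n} {p q : Fin n × Fin n} → SamePair p q → SamePair q p
samePair-sym (inj₁ (refl , refl)) = inj₁ (refl , refl)
samePair-sym (inj₂ (refl , refl)) = inj₂ (refl , refl)

samePair-both : ∀ {n} {P : Fin n → Set} {a b x y} → SamePair (a , b) (x , y) → P a × P b → P x × P y
samePair-both (inj₁ (refl , refl)) (pa , pb) = pa , pb
samePair-both (inj₂ (refl , refl)) (pa , pb) = pb , pa

module _ {n} {G : Graph n} (H : Subgraph G) where

  EH-samePair : ∀ {a b x y} → SamePair (a , b) (x , y) → EH H a b → EH H x y
  EH-samePair (inj₁ (refl , refl)) ab = ab
  EH-samePair (inj₂ (refl , refl)) ab = EH-sym H ab

  connected⇒onEdge : Connected H → ∀ {a b w} → EH H a b → VH H w → ∃[ w′ ] EH H w w′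
  connected⇒onEdge conn {a} {b} {w} ab wH with conn w a wH (proj₁ (EH-V H ab))
  ... | ε       = b , ab
  ... | ww′ ◅ _ = _ , ww′

  module _ (p5free : P5Free G) {u v} (u~v : Adj G u v) (u≁H : ∀ w → VH H w → ¬ Adj G u w) where

    EmptyEdge : EdgeOf H → Set
    EmptyEdge ((x , y) , _) = ¬ Adj G v x × ¬ Adj G v y

    nonNeighbour-P3 : ∀ {x y z} → EH H x y → EH H x z → ¬ Adj G y z →
      ¬ Adj G v x → ¬ Adj G v y → ¬ Adj G v z
    nonNeighbour-P3 {x} {y} {z} xy xz y≁z v≁x v≁y v~z = p5free (inducedP5 G u v z x y
      u~v v~z (sym G (EH-adj H xz)) (EH-adj H xy)
      (u≁H z zH) (u≁H x xH) (u≁H y yH) v≁x v≁y (y≁z ∘ sym G))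
      where
      xH = proj₁ (EH-V H xy)
      yH = proj₂ (EH-V H xy)
      zH = proj₂ (EH-V H xz)

    emptyEdge-P3Step : ∀ {e f} → P3Step H e f → EmptyEdge e → EmptyEdge f
    emptyEdge-P3Step {_ , e∈H} {_ , f∈H} (_ , _ , _ , e≈xy , f≈xz , _ , y≁z) e-empty
      with v≁x , v≁y ← samePair-both e≈xy e-empty =
      samePair-both (samePair-sym f≈xz)
        (v≁x , nonNeighbour-P3 (EH-samePair e≈xy e∈H) (EH-samePair f≈xz f∈H) y≁z v≁x v≁y)

    emptyEdge-Star : ∀ {e f} → Star (P3Step H) e f → EmptyEdge e → EmptyEdge f
    emptyEdge-Star = fold (λ e f → EmptyEdge e → EmptyEdge f) (λ {e} {f} s k → k ∘ emptyEdge-P3Step {e} {f} s) id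

theorem4p1 : ∀ {n} (G : Graph n) (H : Subgraph G) → P5Free G → P3Connected H →
    (u v : Fin n) → ¬ VH H u → ¬ VH H v → Adj G u v →
    (∀ w → VH H w → ¬ Adj G u w) →
    (∃[ a ] ∃[ b ] (EH H a b × ¬ Adj G v a × ¬ Adj G v b)) →
    ∀ w → VH H w → ¬ Adj G v w
theorem4p1 G H p5free (conn , p3conn) u v _ _ u~v u≁H (a , b , ab , v≁a , v≁b) w wH v~w
  with w′ , ww′ ← connected⇒onEdge H conn ab wH =
  proj₁ (emptyEdge-Star H p5free u~v u≁H (p3conn ((a , b) , ab) ((w , w′) , ww′)) (v≁a , v≁b)) v~w
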